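{- Let $k\ge 3$ be fixed, let $d=d(n)$ satisfy $d \to \infty$ and $d = o(n^{1/2})$, with $k \mid nd$. Let $\mathbf{X} = (X_1,\dots,X_{nd})$ be a sequence of independent random variables each uniformly distributed on $[n]$. Then asymptotically almost surely $\mathbf{X}$ has no multiple edges and $\lambda(\mathbf{X}) \le n^{1/4} d^{1/2}$.
   Context: For a sequence $\mathbf{x} \in [n]^{ks}$, its edges are the $k$-tuples $(x_{ki+1},\dots,x_{ki+k})$, $i=0,\dots,s-1$, regarded as multisets. An edge is a loop if it contains some vertex more than once, and proper otherwise. $\mathbf{x}$ has multiple edges if two of its edges are equal as multisets. $\lambda(\mathbf{x})$ is the number of loops of $\mathbf{x}$. Asymptotically almost surely means with probability tending to $1$ as $n\to\infty$. -}

module Defs where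

open import Data.Nat using (ℕ; zero; suc; _+_; _*_; _^_; _≤_; _≥_)
open import Data.Fin using (Fin)
import Data.Fin.Properties as FinP
open import Data.List using (List; []; _∷_; take; drop; length; filter; lookup)
open import Data.Vec using (Vec; toList)
open import Data.Product using (Σ; ∃; _×_; _,_)
open import Relation.Nullary using (¬_; ¬?)
open import Relation.Binary.PropositionalEquality using (_≡_; _≢_)
open import Data.List.Relation.Unary.Unique.Propositional using (Unique)
open import Data.List.Relation.Binary.Permutation.Propositional using (_↭_)
import Data.List.Relation.Unary.Unique.DecPropositional as UDec

-- Split a list into consecutive blocks of length k (the last block may be
-- shorter only if k does not divide the length, which never happens below).
chunksAux : {A : Set} → ℕ → ℕ → List A → List (List A)
chunksAux k zero    xs       = []
chunksAux k (suc f) []       = []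
chunksAux k (suc f) (x ∷ xs) = take k (x ∷ xs) ∷ chunksAux k f (drop k (x ∷ xs))

chunks : {A : Set} → ℕ → List A → List (List A)
chunks k xs = chunksAux k (length xs) xs

-- Its edges are the consecutive
-- k-tuples (x_{ki+1},…,x_{ki+k}), kept as lists; they are compared as
-- multisets via permutation equivalence _↭_.
edges : {n m : ℕ} → ℕ → Vec (Fin n) m → List (List (Fin n))
edges k x = chunks k (toList x)

-- An edge is a loop iff it contains some vertex more than once,
-- i.e. iff it is not a list of distinct elements.
loopCount : {n : ℕ} → List (List (Fin n)) → ℕ
loopCount {n} es = length (filter (λ e → ¬? (UDec.unique? FinP._≟_ e)) es)

λ-loops : {n m : ℕ} → ℕ → Vec (Fin n) m → ℕ
λ-loops k x = loopCount (edges k x)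

HasMultipleEdges : {n m : ℕ} → ℕ → Vec (Fin n) m → Set
HasMultipleEdges k x =
  Σ (Fin (length (edges k x))) λ i → Σ (Fin (length (edges k x))) λ j →
    (i ≢ j) × (lookup (edges k x) i ↭ lookup (edges k x) j)

-- The "good" event of the proposition for parameters k, n, d:
-- no multiple edges and λ(x) ≤ n^{1/4} d^{1/2}, the latter written
-- equivalently (all quantities nonnegative) as λ(x)^4 ≤ n · d^2.
Good : (k n d : ℕ) → Vec (Fin n) (n * d) → Set
Good k n d x = (¬ HasMultipleEdges k x) × (λ-loops k x ^ 4 ≤ n * (d * d))

-- Asymptotically almost surely, for X uniform on [n]^{n d(n)}
-- (i.e. independent uniform coordinates): for every q ≥ 1 there is N such
-- that for all n ≥ N the probability of the good event is at least 1 - 1/q,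
-- witnessed by a duplicate-free list of good sequences of size
-- ≥ (1 - 1/q) · n^{n d(n)}.
AAS : (d : ℕ → ℕ) → ((n : ℕ) → Vec (Fin n) (n * d n) → Set) → Set
AAS d P =
  (q : ℕ) → q ≥ 1 → ∃ λ N → (n : ℕ) → n ≥ N →
    Σ (List (Vec (Fin n) (n * d n))) λ L →
      Unique L × (∀ x → Data.List.Membership.Propositional._∈_ x L → P n x) ×
      ((q Data.Nat.∸ 1) * n ^ (n * d n) ≤ q * length L)
  where import Data.List.Membership.Propositional
        import Data.Nat

TendsToInfinity : (ℕ → ℕ) → Set
TendsToInfinity d = (M : ℕ) → ∃ λ N → (n : ℕ) → n ≥ N → d n ≥ M

-- d(n) = o(n^{1/2}): for every q ≥ 1, eventually d(n) ≤ n^{1/2}/q,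
-- i.e. q² d(n)² ≤ n.
LittleOSqrt : (ℕ → ℕ) → Set
LittleOSqrt d = (q : ℕ) → q ≥ 1 → ∃ λ N → (n : ℕ) → n ≥ N → (q * q) * (d n * d n) ≤ n

-- A first-moment argument, done by exact counting over [n]^m, m = nd = sk:
--   * a loop has a repeated vertex, so λ(X) is at most the number of
--     coinciding index pairs inside edges; hence E λ ≤ s k²/n = dk, and by
--     Markov P(λ > 2qk·d) ≤ 1/(2q), where (2qk)⁴d² ≤ n makes 2qk·d ≤ n^{1/4}d^{1/2};
--   * two edges equal as multisets are included in one another as sets; at
--     most k^k of the n^k tuples lie inside a given edge, so the expected
--     number of inclusions is ≤ s²k^k/n^k ≤ d²k^{k-2}/n ≤ 1/(2q) once
--     (2q k^k)² d² ≤ n.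
-- Both regimes hold eventually since d = o(√n).
module Submission where

open import Defs
open import Data.Nat using (ℕ; _*_; _≥_)
open import Data.Nat.Divisibility using (_∣_)

open import Data.Nat
  using (zero; suc; _+_; _^_; _∸_; _≤_; _<_; _<?_; _≤?_; _⊔_; z≤n; s≤s; NonZero; >-nonZero⁻¹)
open import Data.Nat.Properties
open import Data.Nat.Divisibility using (divides)
open import Data.Nat.ListAction using (sum)
open import Data.Nat.ListAction.Properties using (sum-++)
open import Data.Nat.Tactic.RingSolver using (solve-∀)
open import Algebra.Properties.Semiring.Sum +-*-semiring
  using (sum-syntax; sum-cong-≗; ∑-distrib-+; ∑-comm; *-distribˡ-sum; *-distribʳ-sum)
open import Data.Fin using (Fin; zero; suc)
import Data.Fin.Properties as FinP
open import Data.Vec as Vec using (Vec; []; _∷_; toList)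
import Data.Vec.Properties as VecP
open import Data.List as List
  using (List; []; _∷_; [_]; _++_; length; map; filter; take; drop; tabulate; allFin; cartesianProductWith)
open import Data.List.Properties using (length-++; length-drop; map-++; map-∘)
open import Data.List.Membership.Propositional using (_∈_)
open import Data.List.Membership.Propositional.Properties using (∈-filter⁻)
open import Data.List.Relation.Unary.Any using (any?)
open import Data.List.Relation.Unary.All as All using (All; []; _∷_; all?)
open import Data.List.Relation.Unary.Unique.Propositional using (Unique; []; _∷_)
import Data.List.Relation.Unary.Unique.Propositional.Properties as UniqueP
import Data.List.Relation.Unary.Unique.DecPropositional as UniqueDec
open import Data.List.Relation.Binary.Permutation.Propositional using (_↭_; ↭-sym)
open import Data.List.Relation.Binary.Permutation.Propositional.Properties using (∈-resp-↭)
open import Data.Product using (Σ; _×_; _,_; proj₂)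
open import Function using (_∘_; id)
open import Data.Bool using (true; false)
open import Relation.Nullary using (Dec; _because_; yes; no; ¬_; contradiction; _×-dec_)
open import Relation.Unary using (Pred; Decidable)
open import Relation.Binary.PropositionalEquality
  using (_≡_; _≢_; refl; sym; trans; cong; cong₂; subst; subst₂; module ≡-Reasoning)

𝟙 : ∀ {p} {P : Set p} → Dec P → ℕ
𝟙 (true  because _) = 1
𝟙 (false because _) = 0

𝟙-yes : ∀ {p} {P : Set p} (P? : Dec P) → P → 𝟙 P? ≡ 1
𝟙-yes (yes _) _ = refl
𝟙-yes (no ¬p) p = contradiction p ¬p

𝟙-no : ∀ {p} {P : Set p} (P? : Dec P) → ¬ P → 𝟙 P? ≡ 0
𝟙-no (yes p) ¬p = contradiction p ¬p
𝟙-no (no _)  _  = refl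

∑-mono : ∀ {n} {f g : Fin n → ℕ} → (∀ i → f i ≤ g i) → ∑[ i < n ] f i ≤ ∑[ i < n ] g i
∑-mono {zero}  f≤g = z≤n
∑-mono {suc n} f≤g = +-mono-≤ (f≤g zero) (∑-mono (f≤g ∘ suc))

∑-const : ∀ n c → ∑[ i < n ] c ≡ n * c
∑-const zero    c = refl
∑-const (suc n) c = cong (c +_) (∑-const n c)

∑-*ʳ : ∀ {n} (f : Fin n → ℕ) c → ∑[ i < n ] (f i * c) ≡ (∑[ i < n ] f i) * c
∑-*ʳ f c = sym (*-distribʳ-sum c f)

∑-vanishing : ∀ {n} (f : Fin n → ℕ) → (∀ i → f i ≡ 0) → ∑[ i < n ] f i ≡ 0
∑-vanishing {zero}  f f≡0 = refl
∑-vanishing {suc n} f f≡0 = cong₂ _+_ (f≡0 zero) (∑-vanishing (f ∘ suc) (f≡0 ∘ suc))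

∑-𝟙-≡ : ∀ {n} (y : Fin n) → ∑[ c < n ] 𝟙 (c FinP.≟ y) ≡ 1
∑-𝟙-≡ {suc n} zero = cong₂ _+_ (𝟙-yes (zero {n} FinP.≟ zero) refl)
  (∑-vanishing {n} (λ c → 𝟙 (suc c FinP.≟ zero)) λ c → 𝟙-no (suc c FinP.≟ zero) λ ())
∑-𝟙-≡ {suc n} (suc y) = begin
  𝟙 (zero FinP.≟ suc y) + ∑[ c < n ] 𝟙 (suc c FinP.≟ suc y)
    ≡⟨ cong₂ _+_ (𝟙-no (zero FinP.≟ suc y) λ ()) (sum-cong-≗ λ c → 𝟙-suc c y) ⟩
  ∑[ c < n ] 𝟙 (c FinP.≟ y)
    ≡⟨ ∑-𝟙-≡ y ⟩
  1 ∎
  where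
  open ≡-Reasoning
  𝟙-suc : ∀ {n} (c y : Fin n) → 𝟙 (suc c FinP.≟ suc y) ≡ 𝟙 (c FinP.≟ y)
  𝟙-suc c y with c FinP.≟ y
  ... | yes _ = refl
  ... | no _  = refl

sumSeq : ∀ n m → (Vec (Fin n) m → ℕ) → ℕ
sumSeq n zero    f = f []
sumSeq n (suc m) f = ∑[ a < n ] sumSeq n m (λ x → f (a ∷ x))

module SeqSums (n : ℕ) where

  sumSeq-cong : ∀ m {f g : Vec (Fin n) m → ℕ} → (∀ x → f x ≡ g x) →
                sumSeq n m f ≡ sumSeq n m g
  sumSeq-cong zero    f≡g = f≡g []
  sumSeq-cong (suc m) f≡g = sum-cong-≗ λ a → sumSeq-cong m (λ x → f≡g (a ∷ x))

  sumSeq-mono : ∀ m {f g : Vec (Fin n) m → ℕ} → (∀ x → f x ≤ g x) →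
                sumSeq n m f ≤ sumSeq n m g
  sumSeq-mono zero    f≤g = f≤g []
  sumSeq-mono (suc m) f≤g = ∑-mono λ a → sumSeq-mono m (λ x → f≤g (a ∷ x))

  sumSeq-+ : ∀ m (f g : Vec (Fin n) m → ℕ) →
             sumSeq n m (λ x → f x + g x) ≡ sumSeq n m f + sumSeq n m g
  sumSeq-+ zero    f g = refl
  sumSeq-+ (suc m) f g =
    trans (sum-cong-≗ λ a → sumSeq-+ m (f ∘ (a ∷_)) (g ∘ (a ∷_)))
          (∑-distrib-+ (λ a → sumSeq n m (f ∘ (a ∷_))) (λ a → sumSeq n m (g ∘ (a ∷_))))

  sumSeq-*ˡ : ∀ m c (f : Vec (Fin n) m → ℕ) → sumSeq n m (λ x → c * f x) ≡ c * sumSeq n m f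
  sumSeq-*ˡ zero    c f = refl
  sumSeq-*ˡ (suc m) c f =
    trans (sum-cong-≗ λ a → sumSeq-*ˡ m c (f ∘ (a ∷_)))
          (sym (*-distribˡ-sum c (λ a → sumSeq n m (f ∘ (a ∷_)))))

  sumSeq-const : ∀ m c → sumSeq n m (λ _ → c) ≡ n ^ m * c
  sumSeq-const zero    c = sym (+-identityʳ c)
  sumSeq-const (suc m) c = begin
    ∑[ a < n ] sumSeq n m (λ _ → c) ≡⟨ ∑-const n (sumSeq n m (λ _ → c)) ⟩
    n * sumSeq n m (λ _ → c)        ≡⟨ cong (n *_) (sumSeq-const m c) ⟩
    n * (n ^ m * c)                 ≡⟨ sym (*-assoc n (n ^ m) c) ⟩
    n * n ^ m * c                   ∎
    where open ≡-Reasoning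

  sumSeq-++ : ∀ a b (f : Vec (Fin n) (a + b) → ℕ) →
              sumSeq n (a + b) f ≡ sumSeq n a (λ u → sumSeq n b (λ v → f (u Vec.++ v)))
  sumSeq-++ zero    b f = refl
  sumSeq-++ (suc a) b f = sum-cong-≗ λ c → sumSeq-++ a b (f ∘ (c ∷_))

  sumSeq-comm : ∀ a b (f : Vec (Fin n) a → Vec (Fin n) b → ℕ) →
                sumSeq n a (λ u → sumSeq n b (f u)) ≡
                sumSeq n b (λ v → sumSeq n a (λ u → f u v))
  sumSeq-comm zero    b f = refl
  sumSeq-comm (suc a) b f =
    trans (sum-cong-≗ λ c → sumSeq-comm a b (f ∘ (c ∷_)))
          (∑-sumSeq b (λ c v → sumSeq n a (λ u → f (c ∷ u) v)))
    where
    ∑-sumSeq : ∀ {k} b (g : Fin k → Vec (Fin n) b → ℕ) →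
               ∑[ c < k ] sumSeq n b (g c) ≡ sumSeq n b (λ v → ∑[ c < k ] g c v)
    ∑-sumSeq zero    g = refl
    ∑-sumSeq (suc b) g =
      trans (∑-comm (λ i c → sumSeq n b (λ x → g i (c ∷ x))))
            (sum-cong-≗ λ c → ∑-sumSeq b (λ i x → g i (c ∷ x)))

  sumSeq-sum-comm : ∀ m {A : Set} (g : Vec (Fin n) m → A → ℕ) (es : List A) →
                    sumSeq n m (λ x → sum (map (g x) es)) ≡
                    sum (map (λ e → sumSeq n m (λ x → g x e)) es)
  sumSeq-sum-comm m g []       = trans (sumSeq-const m 0) (*-zeroʳ (n ^ m))
  sumSeq-sum-comm m g (e ∷ es) =
    trans (sumSeq-+ m _ _) (cong (sumSeq n m (λ x → g x e) +_) (sumSeq-sum-comm m g es))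

allSeqs : ∀ n m → List (Vec (Fin n) m)
allSeqs n zero    = [ [] ]
allSeqs n (suc m) = cartesianProductWith _∷_ (allFin n) (allSeqs n m)

allSeqs-unique : ∀ n m → Unique (allSeqs n m)
allSeqs-unique n zero    = [] ∷ []
allSeqs-unique n (suc m) =
  UniqueP.cartesianProductWith⁺ _∷_ VecP.∷-injective (UniqueP.allFin⁺ n) (allSeqs-unique n m)

sum-allSeqs : ∀ n m (g : Vec (Fin n) m → ℕ) → sum (map g (allSeqs n m)) ≡ sumSeq n m g
sum-allSeqs n zero    g = +-identityʳ (g [])
sum-allSeqs n (suc m) g = sum-prefixed id
  where
  -- Generalised over the list tabulate f of first coordinates, for the induction.
  sum-prefixed : ∀ {k} (f : Fin k → Fin n) →
    sum (map g (cartesianProductWith _∷_ (tabulate f) (allSeqs n m))) ≡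
    ∑[ a < k ] sumSeq n m (g ∘ (f a ∷_))
  sum-prefixed {zero}  f = refl
  sum-prefixed {suc k} f = begin
    sum (map g (map (f zero ∷_) Vs ++ rest))
      ≡⟨ cong sum (map-++ g (map (f zero ∷_) Vs) rest) ⟩
    sum (map g (map (f zero ∷_) Vs) ++ map g rest)
      ≡⟨ sum-++ (map g (map (f zero ∷_) Vs)) (map g rest) ⟩
    sum (map g (map (f zero ∷_) Vs)) + sum (map g rest)
      ≡⟨ cong₂ _+_ (trans (cong sum (sym (map-∘ Vs))) (sum-allSeqs n m (g ∘ (f zero ∷_))))
                   (sum-prefixed (f ∘ suc)) ⟩
    sumSeq n m (g ∘ (f zero ∷_)) + ∑[ a < k ] sumSeq n m (g ∘ (f (suc a) ∷_))
      ∎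
    where
    open ≡-Reasoning
    Vs   = allSeqs n m
    rest = cartesianProductWith _∷_ (tabulate (f ∘ suc)) Vs

length-allSeqs : ∀ n m → length (allSeqs n m) ≡ n ^ m
length-allSeqs n m = begin
  length (allSeqs n m)              ≡⟨ length-as-sum (allSeqs n m) ⟩
  sum (map (λ _ → 1) (allSeqs n m)) ≡⟨ sum-allSeqs n m (λ _ → 1) ⟩
  sumSeq n m (λ _ → 1)              ≡⟨ SeqSums.sumSeq-const n m 1 ⟩
  n ^ m * 1                         ≡⟨ *-identityʳ (n ^ m) ⟩
  n ^ m                             ∎
  where
  open ≡-Reasoning
  length-as-sum : ∀ {A : Set} (xs : List A) → length xs ≡ sum (map (λ _ → 1) xs)
  length-as-sum []       = refl
  length-as-sum (x ∷ xs) = cong suc (length-as-sum xs)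

length≤accepted+charge : ∀ {a p} {A : Set a} {P : Pred A p} (P? : Decidable P) (h : A → ℕ) →
  (∀ x → ¬ P x → 1 ≤ h x) → ∀ xs → length xs ≤ length (filter P? xs) + sum (map h xs)
length≤accepted+charge P? h charged []       = z≤n
length≤accepted+charge P? h charged (x ∷ xs) with P? x
... | yes _  = s≤s (≤-trans ih (+-monoʳ-≤ (length (filter P? xs)) (m≤n+m _ (h x))))
  where ih = length≤accepted+charge P? h charged xs
... | no ¬px = begin
  suc (length xs)                                ≤⟨ s≤s ih ⟩
  suc (length (filter P? xs) + sum (map h xs))   ≡⟨ sym (+-suc _ _) ⟩
  length (filter P? xs) + suc (sum (map h xs))   ≤⟨ +-monoʳ-≤ _ (+-monoˡ-≤ _ (charged x ¬px)) ⟩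
  length (filter P? xs) + (h x + sum (map h xs)) ∎
  where
  open ≤-Reasoning
  ih = length≤accepted+charge P? h charged xs

-- The edge decomposition peels off one k-tuple at a time:
-- edges k (u ++ v) = u ∷ edges k v when u has length k ≥ 1.  The only
-- subtlety is the fuel argument of chunksAux, which is irrelevant once it
-- bounds the length of the list.
chunksAux-fuel : ∀ {A : Set} k f g (xs : List A) → length xs ≤ f → length xs ≤ g →
                 chunksAux (suc k) f xs ≡ chunksAux (suc k) g xs
chunksAux-fuel k zero    zero    []       _       _       = refl
chunksAux-fuel k zero    (suc g) []       _       _       = refl
chunksAux-fuel k (suc f) zero    []       _       _       = refl
chunksAux-fuel k (suc f) (suc g) []       _       _       = refl
chunksAux-fuel k (suc f) (suc g) (x ∷ xs) (s≤s p) (s≤s q) =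
  cong (take (suc k) (x ∷ xs) ∷_) (chunksAux-fuel k f g (drop k xs) (shorter p) (shorter q))
  where
  shorter : ∀ {b} → length xs ≤ b → length (drop k xs) ≤ b
  shorter p = ≤-trans (≤-reflexive (length-drop k xs)) (≤-trans (m∸n≤m _ k) p)

take-toList : ∀ {A : Set} {a} (u : Vec A a) r → take a (toList u ++ r) ≡ toList u
take-toList []      r = refl
take-toList (x ∷ u) r = cong (x ∷_) (take-toList u r)

drop-toList : ∀ {A : Set} {a} (u : Vec A a) r → drop a (toList u ++ r) ≡ r
drop-toList []      r = refl
drop-toList (x ∷ u) r = drop-toList u r

edges-++ : ∀ {n m} k (u : Vec (Fin n) (suc k)) (v : Vec (Fin n) m) →
           edges (suc k) (u Vec.++ v) ≡ toList u ∷ edges (suc k) v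
edges-++ k (a ∷ u) v rewrite VecP.toList-++ u v =
  cong₂ _∷_ (take-toList (a ∷ u) (toList v))
    (trans (cong (chunksAux (suc k) (length (toList u ++ toList v))) (drop-toList u (toList v)))
           (chunksAux-fuel k _ _ (toList v) v≤u++v ≤-refl))
  where
  v≤u++v : length (toList v) ≤ length (toList u ++ toList v)
  v≤u++v = ≤-trans (m≤n+m _ (length (toList u))) (≤-reflexive (sym (length-++ (toList u))))

sum-edges≤ : ∀ {n} k s (v : Vec (Fin n) (s * suc k)) (h : List (Fin n) → ℕ) B →
             (∀ (u : Vec (Fin n) (suc k)) → h (toList u) ≤ B) →
             sum (map h (edges (suc k) v)) ≤ s * B
sum-edges≤ k zero    [] h B h≤B = z≤n
sum-edges≤ k (suc s) v  h B h≤B with Vec.splitAt (suc k) v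
... | u , w , refl rewrite edges-++ k u w = +-mono-≤ (h≤B u) (sum-edges≤ k s w h B h≤B)

-- Loops are detected by coincidences: the number of index pairs i < j
-- with e_i = e_j is positive for every edge with a repeated vertex.
multiplicity : ∀ {n} → Fin n → List (Fin n) → ℕ
multiplicity a e = sum (map (λ b → 𝟙 (b FinP.≟ a)) e)

coincidences : ∀ {n} → List (Fin n) → ℕ
coincidences []      = 0
coincidences (a ∷ e) = multiplicity a e + coincidences e

multiplicity-zero : ∀ {n} (a : Fin n) e → multiplicity a e ≡ 0 → All (a ≢_) e
multiplicity-zero a []      _  = []
multiplicity-zero a (b ∷ e) m≡0 with b FinP.≟ a
... | no b≢a = (λ a≡b → b≢a (sym a≡b)) ∷ multiplicity-zero a e m≡0

no-coincidences⇒unique : ∀ {n} (e : List (Fin n)) → coincidences e ≡ 0 → Unique e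
no-coincidences⇒unique []      _   = []
no-coincidences⇒unique (a ∷ e) c≡0 =
  multiplicity-zero a e (m+n≡0⇒m≡0 _ c≡0) ∷
  no-coincidences⇒unique e (m+n≡0⇒n≡0 (multiplicity a e) c≡0)

loopCount-∷ : ∀ {n} (e : List (Fin n)) es → loopCount (e ∷ es) ≤ coincidences e + loopCount es
loopCount-∷ e es with UniqueDec.unique? FinP._≟_ e
... | yes _ = m≤n+m _ _
... | no ¬unique with coincidences e in c≡
...   | zero  = contradiction (no-coincidences⇒unique e c≡) ¬unique
...   | suc _ = s≤s (m≤n+m _ _)

loops-++ : ∀ {n m} k (u : Vec (Fin n) (suc k)) (v : Vec (Fin n) m) →
           λ-loops (suc k) (u Vec.++ v) ≤ coincidences (toList u) + λ-loops (suc k) v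
loops-++ k u v rewrite edges-++ k u v = loopCount-∷ (toList u) (edges (suc k) v)

-- Multiple edges are detected by inclusions: two edges equal as multisets
-- have the first contained (as a set) in the second.  Counting ordered
-- pairs of positions with such an inclusion over-counts multiple edges.
_∈?_ : ∀ {n} (c : Fin n) (w : List (Fin n)) → Dec (c ∈ w)
c ∈? w = any? (c FinP.≟_) w

_⊆?_ : ∀ {n} (e e′ : List (Fin n)) → Dec (All (_∈ e′) e)
e ⊆? e′ = all? (_∈? e′) e

containing : ∀ {n} → List (Fin n) → List (List (Fin n)) → ℕ
containing e es = sum (map (λ e′ → 𝟙 (e ⊆? e′)) es)

inclusions : ∀ {n} → List (List (Fin n)) → ℕ
inclusions []       = 0
inclusions (e ∷ es) = containing e es + inclusions es

↭⇒included : ∀ {n} {e e′ : List (Fin n)} → e ↭ e′ → 𝟙 (e ⊆? e′) ≡ 1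
↭⇒included {e = e} {e′} e↭e′ = 𝟙-yes (e ⊆? e′) (All.tabulate (∈-resp-↭ e↭e′))

term≤sum : ∀ {A : Set} (h : A → ℕ) (es : List A) (j : Fin (length es)) →
           h (List.lookup es j) ≤ sum (map h es)
term≤sum h (e ∷ es) zero    = m≤m+n _ _
term≤sum h (e ∷ es) (suc j) = ≤-trans (term≤sum h es j) (m≤n+m _ _)

head-included : ∀ {n} {e : List (Fin n)} es (j : Fin (length es)) →
                e ↭ List.lookup es j → 1 ≤ inclusions (e ∷ es)
head-included {e = e} es j p = begin
  1                                   ≡⟨ sym (↭⇒included p) ⟩
  𝟙 (e ⊆? List.lookup es j)           ≤⟨ term≤sum (λ e′ → 𝟙 (e ⊆? e′)) es j ⟩
  containing e es                     ≤⟨ m≤m+n _ (inclusions es) ⟩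
  inclusions (e ∷ es)                 ∎
  where open ≤-Reasoning

permuted-pair⇒inclusion : ∀ {n} (es : List (List (Fin n))) (i j : Fin (length es)) → i ≢ j →
                          List.lookup es i ↭ List.lookup es j → 1 ≤ inclusions es
permuted-pair⇒inclusion (e ∷ es) zero    zero    i≢j _ = contradiction refl i≢j
permuted-pair⇒inclusion (e ∷ es) zero    (suc j) _   p = head-included es j p
permuted-pair⇒inclusion (e ∷ es) (suc i) zero    _   p = head-included es i (↭-sym p)
permuted-pair⇒inclusion (e ∷ es) (suc i) (suc j) i≢j p =
  ≤-trans (permuted-pair⇒inclusion es i j (i≢j ∘ cong suc) p) (m≤n+m _ _)

multiple-edges⇒inclusion : ∀ {n m} k (x : Vec (Fin n) m) →
                           HasMultipleEdges k x → 1 ≤ inclusions (edges k x)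
multiple-edges⇒inclusion k x (i , j , i≢j , p) = permuted-pair⇒inclusion (edges k x) i j i≢j p

inclusions-++ : ∀ {n m} k (u : Vec (Fin n) (suc k)) (v : Vec (Fin n) m) →
  inclusions (edges (suc k) (u Vec.++ v)) ≡
  containing (toList u) (edges (suc k) v) + inclusions (edges (suc k) v)
inclusions-++ k u v = cong inclusions (edges-++ k u v)

m+m²≤[1+m]² : ∀ m → m + m * m ≤ suc m * suc m
m+m²≤[1+m]² m = ≤-trans (m≤m+n (m + m * m) (suc m)) (≤-reflexive (square m))
  where
  square : ∀ m → m + m * m + suc m ≡ suc m * suc m
  square = solve-∀

-- First moments.  Throughout, n is the number of vertices; statements are
-- multiplied through by powers of n instead of dividing by them.
module _ {n : ℕ} where
  open SeqSums n

  sumSeq-multiplicity : ∀ a (y : Fin n) →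
    n * sumSeq n a (λ u → multiplicity y (toList u)) ≡ a * n ^ a
  sumSeq-multiplicity zero    y = *-zeroʳ n
  sumSeq-multiplicity (suc a) y = begin
    n * ∑[ b < n ] sumSeq n a (λ u → 𝟙 (b FinP.≟ y) + M u)
      ≡⟨ cong (n *_) (sum-cong-≗ λ b → sumSeq-+ a (λ _ → 𝟙 (b FinP.≟ y)) M) ⟩
    n * ∑[ b < n ] (sumSeq n a (λ _ → 𝟙 (b FinP.≟ y)) + ΣM)
      ≡⟨ cong (n *_) (∑-distrib-+ (λ b → sumSeq n a (λ _ → 𝟙 (b FinP.≟ y))) (λ _ → ΣM))
       ⟩
    n * (∑[ b < n ] sumSeq n a (λ _ → 𝟙 (b FinP.≟ y)) + ∑[ b < n ] ΣM)
      ≡⟨ cong (λ t → n * (t + ∑[ b < n ] ΣM)) hits ⟩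
    n * (n ^ a + ∑[ b < n ] ΣM)
      ≡⟨ cong (λ t → n * (n ^ a + t)) (∑-const n ΣM) ⟩
    n * (n ^ a + n * ΣM)
      ≡⟨ cong (λ t → n * (n ^ a + t)) (sumSeq-multiplicity a y) ⟩
    n * (n ^ a + a * n ^ a)
      ≡⟨ regroup n (n ^ a) a ⟩
    suc a * (n * n ^ a) ∎
    where
    open ≡-Reasoning
    M : Vec (Fin n) a → ℕ
    M u = multiplicity y (toList u)
    ΣM = sumSeq n a M
    hits : ∑[ b < n ] sumSeq n a (λ _ → 𝟙 (b FinP.≟ y)) ≡ n ^ a
    hits = begin
      ∑[ b < n ] sumSeq n a (λ _ → 𝟙 (b FinP.≟ y))
        ≡⟨ sum-cong-≗ (λ b → sumSeq-const a (𝟙 (b FinP.≟ y))) ⟩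
      ∑[ b < n ] (n ^ a * 𝟙 (b FinP.≟ y))
        ≡⟨ sym (*-distribˡ-sum (n ^ a) (λ b → 𝟙 (b FinP.≟ y))) ⟩
      n ^ a * ∑[ b < n ] 𝟙 (b FinP.≟ y)
        ≡⟨ cong (n ^ a *_) (∑-𝟙-≡ y) ⟩
      n ^ a * 1
        ≡⟨ *-identityʳ (n ^ a) ⟩
      n ^ a ∎
    regroup : ∀ n p a → n * (p + a * p) ≡ suc a * (n * p)
    regroup = solve-∀

  -- There are at most a² index pairs, each coinciding with probability 1/n.
  sumSeq-coincidences : ∀ a → n * sumSeq n a (λ u → coincidences (toList u)) ≤ a * a * n ^ a
  sumSeq-coincidences zero    = ≤-reflexive (*-zeroʳ n)
  sumSeq-coincidences (suc a) = begin
    n * ∑[ b < n ] sumSeq n a (λ u → M b u + C u)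
      ≡⟨ cong (n *_) (sum-cong-≗ λ b → sumSeq-+ a (M b) C) ⟩
    n * ∑[ b < n ] (sumSeq n a (M b) + ΣC)
      ≡⟨ cong (n *_) (∑-distrib-+ (λ b → sumSeq n a (M b)) (λ _ → ΣC)) ⟩
    n * (∑[ b < n ] sumSeq n a (M b) + ∑[ b < n ] ΣC)
      ≡⟨ cong (λ t → n * (∑[ b < n ] sumSeq n a (M b) + t)) (∑-const n ΣC) ⟩
    n * (∑[ b < n ] sumSeq n a (M b) + n * ΣC)
      ≡⟨ *-distribˡ-+ n _ (n * ΣC) ⟩
    n * ∑[ b < n ] sumSeq n a (M b) + n * (n * ΣC)
      ≡⟨ cong (_+ n * (n * ΣC)) first-coordinate ⟩
    n * (a * n ^ a) + n * (n * ΣC)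
      ≤⟨ +-monoʳ-≤ (n * (a * n ^ a)) (*-monoʳ-≤ n (sumSeq-coincidences a)) ⟩
    n * (a * n ^ a) + n * (a * a * n ^ a)
      ≡⟨ collect n a (n ^ a) ⟩
    (a + a * a) * (n * n ^ a)
      ≤⟨ *-monoˡ-≤ (n * n ^ a) (m+m²≤[1+m]² a) ⟩
    suc a * suc a * (n * n ^ a) ∎
    where
    open ≤-Reasoning
    M : Fin n → Vec (Fin n) a → ℕ
    M b u = multiplicity b (toList u)
    C : Vec (Fin n) a → ℕ
    C u = coincidences (toList u)
    ΣC = sumSeq n a C
    first-coordinate : n * ∑[ b < n ] sumSeq n a (M b) ≡ n * (a * n ^ a)
    first-coordinate = begin-equality
      n * ∑[ b < n ] sumSeq n a (M b)   ≡⟨ *-distribˡ-sum n (λ b → sumSeq n a (M b)) ⟩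
      ∑[ b < n ] (n * sumSeq n a (M b)) ≡⟨ sum-cong-≗ (sumSeq-multiplicity a) ⟩
      ∑[ b < n ] (a * n ^ a)            ≡⟨ ∑-const n (a * n ^ a) ⟩
      n * (a * n ^ a)                   ∎
    collect : ∀ n a p → n * (a * p) + n * (a * a * p) ≡ (a + a * a) * (n * p)
    collect = solve-∀

  sumSeq-loops-step : ∀ k m →
    sumSeq n (suc k + m) (λ-loops (suc k)) ≤
    n ^ m * sumSeq n (suc k) (λ u → coincidences (toList u)) +
    n ^ suc k * sumSeq n m (λ-loops (suc k))
  sumSeq-loops-step k m = begin
    sumSeq n (K + m) (λ-loops K)
      ≡⟨ sumSeq-++ K m (λ-loops K) ⟩
    sumSeq n K (λ u → sumSeq n m (λ v → λ-loops K (u Vec.++ v)))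
      ≤⟨ sumSeq-mono K (λ u → sumSeq-mono m (λ v → loops-++ k u v)) ⟩
    sumSeq n K (λ u → sumSeq n m (λ v → C u + λ-loops K v))
      ≡⟨ sumSeq-cong K (λ u → trans (sumSeq-+ m (λ _ → C u) (λ-loops K))
                                    (cong (_+ L) (sumSeq-const m (C u)))) ⟩
    sumSeq n K (λ u → n ^ m * C u + L)
      ≡⟨ sumSeq-+ K (λ u → n ^ m * C u) (λ _ → L) ⟩
    sumSeq n K (λ u → n ^ m * C u) + sumSeq n K (λ _ → L)
      ≡⟨ cong₂ _+_ (sumSeq-*ˡ K (n ^ m) C) (sumSeq-const K L) ⟩
    n ^ m * sumSeq n K C + n ^ K * L ∎
    where
    open ≤-Reasoning
    K = suc k
    C : Vec (Fin n) K → ℕ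
    C u = coincidences (toList u)
    L = sumSeq n m (λ-loops K)

  sumSeq-loops : ∀ k s →
    n * sumSeq n (s * suc k) (λ-loops (suc k)) ≤ s * (suc k * suc k) * n ^ (s * suc k)
  sumSeq-loops k zero    = ≤-reflexive (*-zeroʳ n)
  sumSeq-loops k (suc s) = begin
    n * sumSeq n (K + m) (λ-loops K)
      ≤⟨ *-monoʳ-≤ n (sumSeq-loops-step k m) ⟩
    n * (n ^ m * ΣC + n ^ K * L)
      ≡⟨ distribute n (n ^ m) ΣC (n ^ K) L ⟩
    n ^ m * (n * ΣC) + n ^ K * (n * L)
      ≤⟨ +-mono-≤ (*-monoʳ-≤ (n ^ m) (sumSeq-coincidences K))
                  (*-monoʳ-≤ (n ^ K) (sumSeq-loops k s)) ⟩
    n ^ m * (K * K * n ^ K) + n ^ K * (s * (K * K) * n ^ m)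
      ≡⟨ collect (n ^ m) (n ^ K) K s ⟩
    suc s * (K * K) * (n ^ K * n ^ m)
      ≡⟨ cong (suc s * (K * K) *_) (sym (^-distribˡ-+-* n K m)) ⟩
    suc s * (K * K) * n ^ (K + m) ∎
    where
    open ≤-Reasoning
    K = suc k
    m = s * K
    ΣC = sumSeq n K (λ u → coincidences (toList u))
    L = sumSeq n m (λ-loops K)
    distribute : ∀ n p c q l → n * (p * c + q * l) ≡ p * (n * c) + q * (n * l)
    distribute = solve-∀
    collect : ∀ p q K s → p * (K * K * q) + q * (s * (K * K) * p) ≡ suc s * (K * K) * (q * p)
    collect = solve-∀

  ∑-𝟙-∈ : ∀ (w : List (Fin n)) → ∑[ c < n ] 𝟙 (c ∈? w) ≤ length w
  ∑-𝟙-∈ []      = ≤-reflexive (∑-vanishing {n} (λ c → 𝟙 (c ∈? [])) λ _ → refl)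
  ∑-𝟙-∈ (y ∷ w) = begin
    ∑[ c < n ] 𝟙 (c ∈? (y ∷ w))
      ≤⟨ ∑-mono (λ c → 𝟙-any-∷ c) ⟩
    ∑[ c < n ] (𝟙 (c FinP.≟ y) + 𝟙 (c ∈? w))
      ≡⟨ ∑-distrib-+ (λ c → 𝟙 (c FinP.≟ y)) (λ c → 𝟙 (c ∈? w)) ⟩
    ∑[ c < n ] 𝟙 (c FinP.≟ y) + ∑[ c < n ] 𝟙 (c ∈? w)
      ≡⟨ cong (_+ ∑[ c < n ] 𝟙 (c ∈? w)) (∑-𝟙-≡ y) ⟩
    suc (∑[ c < n ] 𝟙 (c ∈? w))
      ≤⟨ s≤s (∑-𝟙-∈ w) ⟩
    suc (length w) ∎
    where
    open ≤-Reasoning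
    𝟙-any-∷ : ∀ c → 𝟙 (c ∈? (y ∷ w)) ≤ 𝟙 (c FinP.≟ y) + 𝟙 (c ∈? w)
    𝟙-any-∷ c with c FinP.≟ y | c ∈? w
    ... | yes _ | _     = s≤s z≤n
    ... | no _  | yes _ = s≤s z≤n
    ... | no _  | no _  = z≤n

  𝟙-⊆?-∷ : ∀ c (e w : List (Fin n)) → 𝟙 ((c ∷ e) ⊆? w) ≡ 𝟙 (c ∈? w) * 𝟙 (e ⊆? w)
  𝟙-⊆?-∷ c e w with c ∈? w | e ⊆? w
  ... | yes _ | yes _ = refl
  ... | yes _ | no _  = refl
  ... | no _  | _     = refl

  sumSeq-included : ∀ a (w : List (Fin n)) → sumSeq n a (λ u → 𝟙 (toList u ⊆? w)) ≤ length w ^ a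
  sumSeq-included zero    w = s≤s z≤n
  sumSeq-included (suc a) w = begin
    ∑[ c < n ] sumSeq n a (λ u → 𝟙 ((c ∷ toList u) ⊆? w))
      ≡⟨ sum-cong-≗ (λ c → trans (sumSeq-cong a (λ u → 𝟙-⊆?-∷ c (toList u) w))
                                  (sumSeq-*ˡ a (𝟙 (c ∈? w)) I)) ⟩
    ∑[ c < n ] (𝟙 (c ∈? w) * sumSeq n a I)
      ≤⟨ ∑-mono (λ c → *-monoʳ-≤ (𝟙 (c ∈? w)) (sumSeq-included a w)) ⟩
    ∑[ c < n ] (𝟙 (c ∈? w) * length w ^ a)
      ≡⟨ ∑-*ʳ (λ c → 𝟙 (c ∈? w)) (length w ^ a) ⟩
    ∑[ c < n ] 𝟙 (c ∈? w) * length w ^ a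
      ≤⟨ *-monoˡ-≤ (length w ^ a) (∑-𝟙-∈ w) ⟩
    length w * length w ^ a ∎
    where
    open ≤-Reasoning
    I : Vec (Fin n) a → ℕ
    I u = 𝟙 (toList u ⊆? w)

  -- Inclusions of a new first edge u in one of the s edges of v, summed
  -- over u and v: for each edge w of v at most k^k choices of u lie inside w.
  sumSeq-new-inclusions : ∀ k s →
    sumSeq n (suc k) (λ u → sumSeq n (s * suc k) (λ v → containing (toList u) (edges (suc k) v)))
      ≤ n ^ (s * suc k) * (s * suc k ^ suc k)
  sumSeq-new-inclusions k s = begin
    sumSeq n K (λ u → sumSeq n m (λ v → sum (map (g u) (edges K v))))
      ≡⟨ sumSeq-comm K m (λ u v → sum (map (g u) (edges K v))) ⟩
    sumSeq n m (λ v → sumSeq n K (λ u → sum (map (g u) (edges K v))))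
      ≡⟨ sumSeq-cong m (λ v → sumSeq-sum-comm K g (edges K v)) ⟩
    sumSeq n m (λ v → sum (map (λ e′ → sumSeq n K (λ u → g u e′)) (edges K v)))
      ≤⟨ sumSeq-mono m (λ v → sum-edges≤ k s v (λ e′ → sumSeq n K (λ u → g u e′)) (K ^ K) per-edge) ⟩
    sumSeq n m (λ _ → s * K ^ K)
      ≡⟨ sumSeq-const m (s * K ^ K) ⟩
    n ^ m * (s * K ^ K) ∎
    where
    open ≤-Reasoning
    K = suc k
    m = s * K
    g : Vec (Fin n) K → List (Fin n) → ℕ
    g u e′ = 𝟙 (toList u ⊆? e′)
    per-edge : ∀ (w : Vec (Fin n) K) → sumSeq n K (λ u → g u (toList w)) ≤ K ^ K
    per-edge w = subst (λ ℓ → sumSeq n K (λ u → g u (toList w)) ≤ ℓ ^ K)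
                       (VecP.length-toList w) (sumSeq-included K (toList w))

  sumSeq-inclusions-step : ∀ k s →
    sumSeq n (suc k + s * suc k) (λ x → inclusions (edges (suc k) x)) ≤
    n ^ (s * suc k) * (s * suc k ^ suc k) +
    n ^ suc k * sumSeq n (s * suc k) (λ x → inclusions (edges (suc k) x))
  sumSeq-inclusions-step k s = begin
    sumSeq n (K + m) I
      ≡⟨ sumSeq-++ K m I ⟩
    sumSeq n K (λ u → sumSeq n m (λ v → I (u Vec.++ v)))
      ≡⟨ sumSeq-cong K (λ u → trans (sumSeq-cong m (λ v → inclusions-++ k u v))
                                    (sumSeq-+ m (new u) I)) ⟩
    sumSeq n K (λ u → sumSeq n m (new u) + ΣI)
      ≡⟨ trans (sumSeq-+ K (λ u → sumSeq n m (new u)) (λ _ → ΣI))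
               (cong (Σnew +_) (sumSeq-const K ΣI)) ⟩
    Σnew + n ^ K * ΣI
      ≤⟨ +-monoˡ-≤ (n ^ K * ΣI) (sumSeq-new-inclusions k s) ⟩
    n ^ m * (s * K ^ K) + n ^ K * ΣI ∎
    where
    open ≤-Reasoning
    K = suc k
    m = s * K
    I : ∀ {l} → Vec (Fin n) l → ℕ
    I x = inclusions (edges K x)
    new : Vec (Fin n) K → Vec (Fin n) m → ℕ
    new u v = containing (toList u) (edges K v)
    ΣI = sumSeq n m I
    Σnew = sumSeq n K (λ u → sumSeq n m (new u))

  sumSeq-inclusions : ∀ k s →
    n ^ suc k * sumSeq n (s * suc k) (λ x → inclusions (edges (suc k) x)) ≤
    s * s * suc k ^ suc k * n ^ (s * suc k)
  sumSeq-inclusions k zero    = ≤-reflexive (*-zeroʳ (n ^ suc k))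
  sumSeq-inclusions k (suc s) = begin
    n ^ K * sumSeq n (K + m) I
      ≤⟨ *-monoʳ-≤ (n ^ K) (sumSeq-inclusions-step k s) ⟩
    n ^ K * (n ^ m * (s * K ^ K) + n ^ K * ΣI)
      ≡⟨ *-distribˡ-+ (n ^ K) (n ^ m * (s * K ^ K)) (n ^ K * ΣI) ⟩
    n ^ K * (n ^ m * (s * K ^ K)) + n ^ K * (n ^ K * ΣI)
      ≤⟨ +-monoʳ-≤ (n ^ K * (n ^ m * (s * K ^ K))) (*-monoʳ-≤ (n ^ K) (sumSeq-inclusions k s))
       ⟩
    n ^ K * (n ^ m * (s * K ^ K)) + n ^ K * (s * s * K ^ K * n ^ m)
      ≡⟨ collect (n ^ K) (n ^ m) s (K ^ K) ⟩
    (s + s * s) * K ^ K * (n ^ K * n ^ m)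
      ≤⟨ *-monoˡ-≤ (n ^ K * n ^ m) (*-monoˡ-≤ (K ^ K) (m+m²≤[1+m]² s)) ⟩
    suc s * suc s * K ^ K * (n ^ K * n ^ m)
      ≡⟨ cong (suc s * suc s * K ^ K *_) (sym (^-distribˡ-+-* n K m)) ⟩
    suc s * suc s * K ^ K * n ^ (K + m) ∎
    where
    open ≤-Reasoning
    K = suc k
    m = s * K
    I : ∀ {l} → Vec (Fin n) l → ℕ
    I x = inclusions (edges K x)
    ΣI = sumSeq n m I
    collect : ∀ p q s c → p * (q * (s * c)) + p * (s * s * c * q) ≡ (s + s * s) * c * (p * q)
    collect = solve-∀

markov : ∀ n m (f : Vec (Fin n) m → ℕ) t →
         sumSeq n m (λ x → 𝟙 (t <? f x)) * suc t ≤ sumSeq n m f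
markov n m f t = begin
  sumSeq n m B * suc t               ≡⟨ *-comm _ (suc t) ⟩
  suc t * sumSeq n m B               ≡⟨ sym (sumSeq-*ˡ m (suc t) B) ⟩
  sumSeq n m (λ x → suc t * B x)     ≤⟨ sumSeq-mono m (λ x → exceeds (f x)) ⟩
  sumSeq n m f                       ∎
  where
  open ≤-Reasoning
  open SeqSums n
  B : Vec (Fin n) m → ℕ
  B x = 𝟙 (t <? f x)
  exceeds : ∀ v → suc t * 𝟙 (t <? v) ≤ v
  exceeds v with t <? v
  ... | yes t<v = ≤-trans (≤-reflexive (*-identityʳ (suc t))) t<v
  ... | no _    = ≤-trans (≤-reflexive (*-zeroʳ (suc t))) z≤n

-- From a·(1 + r·c) ≤ c·b conclude r·a ≤ b: cancel c if c > 0, and if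
-- c = 0 the hypothesis forces a = 0.  This turns both first-moment bounds
-- into tail bounds.
scale-down : ∀ r a b c → a * suc (r * c) ≤ c * b → r * a ≤ b
scale-down r a b zero    h =
  subst (λ t → r * t ≤ b) (sym (n≤0⇒n≡0 a≤0)) (≤-trans (≤-reflexive (*-zeroʳ r)) z≤n)
  where
  a≤0 : a ≤ 0
  a≤0 = ≤-trans (m≤m*n a (suc (r * 0))) h
scale-down r a b (suc c) h = *-cancelˡ-≤ (suc c) (begin
  suc c * (r * a)      ≡⟨ rearrange (suc c) r a ⟩
  a * (r * suc c)      ≤⟨ *-monoʳ-≤ a (n≤1+n (r * suc c)) ⟩
  a * suc (r * suc c)  ≤⟨ h ⟩
  suc c * b            ∎)
  where
  open ≤-Reasoning
  rearrange : ∀ c r a → c * (r * a) ≡ a * (r * c)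
  rearrange = solve-∀

good-fraction : ∀ q X G B → X ≤ G + B → q * B ≤ X → (q ∸ 1) * X ≤ q * G
good-fraction q X G B X≤G+B qB≤X = begin
  (q ∸ 1) * X   ≡⟨ *-distribʳ-∸ X q 1 ⟩
  q * X ∸ 1 * X ≡⟨ cong (q * X ∸_) (*-identityˡ X) ⟩
  q * X ∸ X     ≤⟨ m≤n+o⇒m∸n≤o (q * X) X qX≤X+qG ⟩
  q * G         ∎
  where
  open ≤-Reasoning
  qX≤X+qG : q * X ≤ X + q * G
  qX≤X+qG = begin
    q * X          ≤⟨ *-monoʳ-≤ q X≤G+B ⟩
    q * (G + B)    ≡⟨ *-distribˡ-+ q G B ⟩
    q * G + q * B  ≤⟨ +-monoʳ-≤ (q * G) qB≤X ⟩
    q * G + X      ≡⟨ +-comm (q * G) X ⟩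
    X + q * G      ∎

m≤m*m : ∀ m → m ≤ m * m
m≤m*m zero    = z≤n
m≤m*m (suc m) = m≤m*n (suc m) (suc m)

-- Loops are compared with the threshold t = T·d and inclusions need the
-- regime Q²d² ≤ n; LittleOSqrt makes both regimes eventual.
module Tails (k q : ℕ) where

  K T Q : ℕ
  K = suc (suc (suc k))
  T = 2 * q * K
  Q = 2 * q * K ^ K

  -- Edges have at least three vertices, so n³ ≤ n^K.
  3≤K : 3 ≤ K
  3≤K = s≤s (s≤s (s≤s z≤n))

  2q-positive : 1 ≤ q → 1 ≤ 2 * q
  2q-positive = *-mono-≤ {1} {2} (s≤s z≤n)

  T²-positive : 1 ≤ q → 1 ≤ T * T
  T²-positive q≥1 = *-mono-≤ T-positive T-positive
    where T-positive = *-mono-≤ (2q-positive q≥1) (s≤s z≤n)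

  Q-positive : 1 ≤ q → 1 ≤ Q
  Q-positive q≥1 = *-mono-≤ (2q-positive q≥1) (>-nonZero⁻¹ (K ^ K) {{m^n≢0 K K}})

  -- The decidable good event: no inclusions between edges (hence no
  -- multiple edges) and λ(x)^4 ≤ n·d².
  Fine : ∀ n d {m} → Vec (Fin n) m → Set
  Fine n d x = inclusions (edges K x) ≡ 0 × λ-loops K x ^ 4 ≤ n * (d * d)

  fine? : ∀ n d {m} → Decidable (Fine n d {m})
  fine? n d x = (inclusions (edges K x) ≟ 0) ×-dec (λ-loops K x ^ 4 ≤? n * (d * d))

  fine⇒good : ∀ n d (x : Vec (Fin n) (n * d)) → Fine n d x → Good K n d x
  fine⇒good n d x (no-inclusions , few-loops) =
    (λ multiple → 1≰0 (subst (1 ≤_) no-inclusions (multiple-edges⇒inclusion K x multiple))) ,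
    few-loops
    where
    1≰0 : ¬ 1 ≤ 0
    1≰0 ()

  charge : ∀ d {n m} → Vec (Fin n) m → ℕ
  charge d x = inclusions (edges K x) + 𝟙 (T * d <? λ-loops K x)

  -- In the loop regime (T·d)^4 ≤ n·d², so every sequence that is not fine
  -- is charged.
  unfine⇒charged : ∀ n d → T * T * (T * T) * (d * d) ≤ n →
                   ∀ {m} (x : Vec (Fin n) m) → ¬ Fine n d x → 1 ≤ charge d x
  unfine⇒charged n d regime x ¬fine with inclusions (edges K x)
  ... | suc _ = s≤s z≤n
  ... | zero  = ≤-reflexive (sym (𝟙-yes (T * d <? λ-loops K x) many-loops))
    where
    threshold⁴ : (T * d) ^ 4 ≤ n * (d * d)
    threshold⁴ = ≤-trans (≤-reflexive (regroup T d)) (*-monoˡ-≤ (d * d) regime)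
      where
      regroup : ∀ T d → T * d * (T * d * (T * d * (T * d * 1))) ≡
                        T * T * (T * T) * (d * d) * (d * d)
      regroup = solve-∀
    many-loops : T * d < λ-loops K x
    many-loops = ≰⇒> λ few → ¬fine (refl , ≤-trans (^-monoˡ-≤ 4 few) threshold⁴)

  module _ (n d : ℕ) .{{_ : NonZero n}} (s : ℕ) (nd≡sK : n * d ≡ s * K) where

    -- E λ ≤ dK, so by Markov λ > T·d with probability at most 1/(2q).
    loop-tail : 2 * q * sumSeq n (s * K) (λ x → 𝟙 (T * d <? λ-loops K x)) ≤ n ^ (s * K)
    loop-tail = scale-down (2 * q) B X (d * K) (begin
      B * suc (2 * q * (d * K))    ≡⟨ cong (λ t → B * suc t) (regroup q K d) ⟩
      B * suc (T * d)              ≤⟨ markov n (s * K) (λ-loops K) (T * d) ⟩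
      sumSeq n (s * K) (λ-loops K) ≤⟨ expected-loops ⟩
      d * K * X                    ∎)
      where
      open ≤-Reasoning
      X = n ^ (s * K)
      B = sumSeq n (s * K) (λ x → 𝟙 (T * d <? λ-loops K x))
      regroup : ∀ q K d → 2 * q * (d * K) ≡ 2 * q * K * d
      regroup = solve-∀
      expected-loops : sumSeq n (s * K) (λ-loops K) ≤ d * K * X
      expected-loops = *-cancelˡ-≤ n (begin
        n * sumSeq n (s * K) (λ-loops K) ≤⟨ sumSeq-loops (suc (suc k)) s ⟩
        s * (K * K) * X                  ≡⟨ regroup₁ s K X ⟩
        s * K * (K * X)                  ≡⟨ cong (_* (K * X)) (sym nd≡sK) ⟩
        n * d * (K * X)                  ≡⟨ regroup₂ n d K X ⟩
        n * (d * K * X)                  ∎)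
        where
        regroup₁ : ∀ s K X → s * (K * K) * X ≡ s * K * (K * X)
        regroup₁ = solve-∀
        regroup₂ : ∀ n d K X → n * d * (K * X) ≡ n * (d * K * X)
        regroup₂ = solve-∀

    -- E #inclusions ≤ s²K^K/n^K ≤ d²K^(K-2)/n since n³ ≤ n^K; in the regime
    -- Q²d² ≤ n this is at most 1/(2q).
    inclusion-tail : Q * Q * (d * d) ≤ n →
      2 * q * sumSeq n (s * K) (λ x → inclusions (edges K x)) ≤ n ^ (s * K)
    inclusion-tail regime = scale-down (2 * q) I X (d * d * K ^ K) (begin
      I * suc (2 * q * (d * d * K ^ K))  ≤⟨ *-monoʳ-≤ I room ⟩
      I * (K * K * n)                    ≡⟨ *-comm I (K * K * n) ⟩
      K * K * n * I                      ≤⟨ expected-inclusions ⟩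
      d * d * K ^ K * X                  ∎)
      where
      open ≤-Reasoning
      X = n ^ (s * K)
      I = sumSeq n (s * K) (λ x → inclusions (edges K x))
      expected-inclusions : K * K * n * I ≤ d * d * K ^ K * X
      expected-inclusions = *-cancelˡ-≤ (n * n) {{m*n≢0 n n}} (begin
        n * n * (K * K * n * I)       ≡⟨ regroup₁ n K I ⟩
        K * K * (n ^ 3 * I)           ≤⟨ *-monoʳ-≤ (K * K) (*-monoˡ-≤ I n³≤nᴷ) ⟩
        K * K * (n ^ K * I)           ≤⟨ *-monoʳ-≤ (K * K) (sumSeq-inclusions (suc (suc k)) s) ⟩
        K * K * (s * s * K ^ K * X)   ≡⟨ regroup₂ K s (K ^ K) X ⟩
        s * K * (s * K) * (K ^ K * X) ≡⟨ cong (λ t → t * t * (K ^ K * X)) (sym nd≡sK) ⟩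
        n * d * (n * d) * (K ^ K * X) ≡⟨ regroup₃ n d (K ^ K) X ⟩
        n * n * (d * d * K ^ K * X)   ∎)
        where
        regroup₁ : ∀ n K I → n * n * (K * K * n * I) ≡ K * K * (n * (n * (n * 1)) * I)
        regroup₁ = solve-∀
        regroup₂ : ∀ K s P X → K * K * (s * s * P * X) ≡ s * K * (s * K) * (P * X)
        regroup₂ = solve-∀
        regroup₃ : ∀ n d P X → n * d * (n * d) * (P * X) ≡ n * n * (d * d * P * X)
        regroup₃ = solve-∀
        n³≤nᴷ : n ^ 3 ≤ n ^ K
        n³≤nᴷ = ^-monoʳ-≤ n 3≤K
      room : suc (2 * q * (d * d * K ^ K)) ≤ K * K * n
      room = begin
        suc (2 * q * (d * d * K ^ K)) ≡⟨ cong suc (regroup q (d * d) (K ^ K)) ⟩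
        suc (Q * (d * d))             ≤⟨ s≤s (*-monoˡ-≤ (d * d) (m≤m*m Q)) ⟩
        suc (Q * Q * (d * d))         ≤⟨ s≤s regime ⟩
        suc n                         ≤⟨ +-monoˡ-≤ n (>-nonZero⁻¹ n) ⟩
        n + n                         ≡⟨ cong (n +_) (sym (+-identityʳ n)) ⟩
        2 * n                         ≤⟨ *-monoˡ-≤ n 2≤K² ⟩
        K * K * n                     ∎
        where
        regroup : ∀ q D P → 2 * q * (D * P) ≡ 2 * q * P * D
        regroup = solve-∀
        2≤K² : 2 ≤ K * K
        2≤K² = ≤-trans (n≤1+n 2) (≤-trans 3≤K (m≤m*n K K))

    total-charge : Q * Q * (d * d) ≤ n → q * sumSeq n (s * K) (charge d) ≤ n ^ (s * K)
    total-charge regime = *-cancelˡ-≤ 2 (begin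
      2 * (q * sumSeq n (s * K) (charge d)) ≡⟨ sym (*-assoc 2 q _) ⟩
      2 * q * sumSeq n (s * K) (charge d)   ≡⟨ cong (2 * q *_) (SeqSums.sumSeq-+ n (s * K) I L) ⟩
      2 * q * (ΣI + ΣL)                     ≡⟨ *-distribˡ-+ (2 * q) ΣI ΣL ⟩
      2 * q * ΣI + 2 * q * ΣL               ≤⟨ +-mono-≤ (inclusion-tail regime) loop-tail ⟩
      X + X                                 ≡⟨ cong (X +_) (sym (+-identityʳ X)) ⟩
      2 * X                                 ∎)
      where
      open ≤-Reasoning
      X = n ^ (s * K)
      I L : Vec (Fin n) (s * K) → ℕ
      I x = inclusions (edges K x)
      L x = 𝟙 (T * d <? λ-loops K x)
      ΣI = sumSeq n (s * K) I
      ΣL = sumSeq n (s * K) L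

  good-list : ∀ n d .{{_ : NonZero n}} s → n * d ≡ s * K →
    T * T * (T * T) * (d * d) ≤ n → Q * Q * (d * d) ≤ n →
    Σ (List (Vec (Fin n) (n * d))) λ L →
      Unique L × (∀ x → x ∈ L → Good K n d x) × ((q ∸ 1) * n ^ (n * d) ≤ q * length L)
  good-list n d s nd≡sK loop-regime inclusion-regime =
    L , UniqueP.filter⁺ (fine? n d) (allSeqs-unique n m) ,
    (λ x x∈L → fine⇒good n d x (proj₂ (∈-filter⁻ (fine? n d) {xs = allSeqs n m} x∈L))) ,
    good-fraction q (n ^ m) (length L) (sumSeq n m (charge d)) covered charge-bound
    where
    m = n * d
    L = filter (fine? n d) (allSeqs n m)
    covered : n ^ m ≤ length L + sumSeq n m (charge d)
    covered = subst₂ (λ a b → a ≤ length L + b) (length-allSeqs n m) (sum-allSeqs n m (charge d))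
      (length≤accepted+charge (fine? n d) (charge d) (unfine⇒charged n d loop-regime) (allSeqs n m))
    charge-bound : q * sumSeq n m (charge d) ≤ n ^ m
    charge-bound = subst (λ l → q * sumSeq n l (charge d) ≤ n ^ l) (sym nd≡sK)
      (total-charge n d s nd≡sK inclusion-regime)

-- Given q, choose N beyond both regimes (and ≥ 1); for each n ≥ N the
-- divisibility K ∣ nd provides s with nd = sK, and good-list applies.
proposition5 : (k : ℕ) → k ≥ 3 → (d : ℕ → ℕ) →
  TendsToInfinity d → LittleOSqrt d → ((n : ℕ) → k ∣ n * d n) →
  AAS d (λ n x → Good k n (d n) x)
proposition5 (suc (suc (suc k))) (s≤s (s≤s (s≤s z≤n))) d _ d=o[√n] K∣nd q q≥1 =
  let N₁ , loop-regime      = d=o[√n] (T * T) (T²-positive q≥1)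
      N₂ , inclusion-regime = d=o[√n] Q (Q-positive q≥1)
  in suc (N₁ ⊔ N₂) , λ where
    (suc n) (s≤s N≤n) →
      let divides s nd≡sK = K∣nd (suc n)
          N₁≤n = m≤n⇒m≤1+n (≤-trans (m≤m⊔n N₁ N₂) N≤n)
          N₂≤n = m≤n⇒m≤1+n (≤-trans (m≤n⊔m N₁ N₂) N≤n)
      in good-list (suc n) (d (suc n)) s nd≡sK
                   (loop-regime (suc n) N₁≤n) (inclusion-regime (suc n) N₂≤n)
  where open Tails k q
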